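{- Let $k\geq 3$ be an integer and let $G$ be a finite connected twin-free graph. Then $G$ admits a proper vertex coloring with $k$ colors if and only if $G^{*}$ admits an $rlid$-coloring using at most $k$ colors.
   Context: A graph is twin-free if no two distinct vertices $u,v$ satisfy $N[u]=N[v]$, where $N[x]$ is the closed neighborhood. Given a graph $G$, the graph $G^*$ is obtained from $G$ by replacing each edge $xy$ of $G$ by a path $x a b y$ of length $3$ (with two new internal vertices $a,b$ per edge), and attaching to each vertex of $G$ one new pendant vertex (a new vertex of degree one adjacent to it). An $rlid$-coloring of a graph $H$ is a map $c:V(H)\to\mathbb{N}$ (not necessarily proper) such that for every pair of adjacent vertices $u,v$ with $N[u]\neq N[v]$ we have $c(N[u])\neq c(N[v])$, where $c(X)=\{c(x):x\in X\}$. -}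

module Defs where

open import Data.Nat using (ℕ)
open import Data.Fin using (Fin)
open import Data.Bool using (Bool; true; false; T)
open import Data.Product using (Σ; ∃; _×_; _,_)
open import Data.Sum using (_⊎_)
open import Relation.Binary.PropositionalEquality using (_≡_; _≢_)
open import Relation.Nullary using (¬_)
open import Function.Bundles using (_⇔_)

record Graph (n : ℕ) : Set where
  field
    adj    : Fin n → Fin n → Bool
    sym    : ∀ i j → adj i j ≡ adj j i
    irrefl : ∀ i → adj i i ≡ false
open Graph public

Edge : ∀ {n} → Graph n → Fin n → Fin n → Set
Edge G i j = T (adj G i j)

module _ {V : Set} (E : V → V → Set) where

  ClosedNbhd : V → V → Set
  ClosedNbhd u x = (x ≡ u) ⊎ E u x

  SameClosedNbhd : V → V → Set
  SameClosedNbhd u v = ∀ x → ClosedNbhd u x ⇔ ClosedNbhd v x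

  TwinFree : Set
  TwinFree = ∀ u v → SameClosedNbhd u v → u ≡ v

  data Reach : V → V → Set where
    here : ∀ {u} → Reach u u
    step : ∀ {u v w} → E u v → Reach v w → Reach u w

  Connected : Set
  Connected = ∀ u v → Reach u v

  ColoursOf : {C : Set} → (V → C) → V → C → Set
  ColoursOf c u a = ∃ λ x → ClosedNbhd u x × c x ≡ a

  IsRlidColouring : {C : Set} → (V → C) → Set
  IsRlidColouring c = ∀ u v → E u v → ¬ SameClosedNbhd u v →
    ¬ (∀ a → ColoursOf c u a ⇔ ColoursOf c v a)

  IsProperColouring : {C : Set} → (V → C) → Set
  IsProperColouring c = ∀ u v → E u v → c u ≢ c v

-- The graph G*: every edge xy replaced by a path x a b y, and a pendant
-- vertex attached to every original vertex.  The internal vertex of edge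
-- {i,j} adjacent to i is  sub i j _ ; the one adjacent to j is  sub j i _.
data StarV {n : ℕ} (G : Graph n) : Set where
  orig : Fin n → StarV G
  pend : Fin n → StarV G
  sub  : (i j : Fin n) → Edge G i j → StarV G

data StarE {n : ℕ} (G : Graph n) : StarV G → StarV G → Set where
  orig-pend : ∀ i → StarE G (orig i) (pend i)
  pend-orig : ∀ i → StarE G (pend i) (orig i)
  orig-sub  : ∀ i j (e : Edge G i j) → StarE G (orig i) (sub i j e)
  sub-orig  : ∀ i j (e : Edge G i j) → StarE G (sub i j e) (orig i)
  sub-sub   : ∀ i j (e : Edge G i j) (e' : Edge G j i) →
              StarE G (sub i j e) (sub j i e')

module Submission where

-- (⇒) From a proper colouring c with k ≥ 3 colours, give both inner vertices
-- of the path replacing xy the colour third (c x) (c y), one of 0, 1, 2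
-- avoiding c x and c y, and give the pendant vertex of x a colour that
-- differs from c x and from every colour on the inner vertices next to x, if
-- such a colour exists, and c x otherwise.  Every edge of G* whose ends are not
-- twins then has a colour seen by one end and not by the other.
-- (⇐) If c x = c y for an edge xy, the two inner vertices of its path see the
-- same colours, yet they are not twins (only one of them is adjacent to x), so
-- the restriction of an rlid-colouring of G* to V(G) is proper.

open import Defs hiding (sym)
open import Data.Nat using (ℕ; _≥_; _+_; suc; s≤s)
open import Data.Fin using (Fin; zero; suc; _≟_)
open import Data.Fin.Properties using (any?)
open import Data.Bool using (T)
open import Data.Bool.Properties using (T-irrelevant)
open import Data.Product using (Σ; ∃; ∃-syntax; _×_; _,_; proj₁; proj₂)
open import Data.Sum using (_⊎_; inj₁; inj₂; [_,_])
open import Data.Empty using (⊥-elim)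
open import Function using (_∘_)
open import Relation.Nullary using (¬_; Dec; yes; no)
open import Relation.Nullary.Decidable using (_×-dec_; ¬?; decidable-stable; T?)
open import Relation.Binary.PropositionalEquality
  using (_≡_; _≢_; refl; cong; subst; trans) renaming (sym to ≡-sym)
open import Function.Bundles using (_⇔_; mk⇔; Equivalence)
open import Function.Properties.Equivalence using () renaming (sym to ⇔-sym)

module _ {V : Set} (E : V → V → Set) {C : Set} (c : V → C) where

  SameColours : V → V → Set
  SameColours u v = ∀ a → ColoursOf E c u a ⇔ ColoursOf E c v a

  Separates : V → V → C → Set
  Separates u v a = ColoursOf E c u a × ¬ ColoursOf E c v a

  separates⇒¬SameColours : ∀ {u v a} → Separates u v a → ¬ SameColours u v
  separates⇒¬SameColours (a∈u , a∉v) same = a∉v (Equivalence.to (same _) a∈u)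

  separates⇒¬SameColours′ : ∀ {u v a} → Separates v u a → ¬ SameColours u v
  separates⇒¬SameColours′ (a∈v , a∉u) same = a∉u (Equivalence.from (same _) a∈v)

  neighbour-colour : ∀ {u v} → E u v → ColoursOf E c u (c v)
  neighbour-colour {v = v} e = v , inj₂ e , refl

third : ∀ {m} → Fin (3 + m) → Fin (3 + m) → Fin (3 + m)
third zero       (suc zero) = suc (suc zero)
third (suc zero) zero       = suc (suc zero)
third zero       _          = suc zero
third (suc zero) _          = zero
third _          zero       = suc zero
third _          _          = zero

third-comm : ∀ {m} (a b : Fin (3 + m)) → third a b ≡ third b a
third-comm zero             zero             = refl
third-comm zero             (suc zero)       = refl
third-comm zero             (suc (suc _))    = refl
third-comm (suc zero)       zero             = refl
third-comm (suc zero)       (suc zero)       = refl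
third-comm (suc zero)       (suc (suc _))    = refl
third-comm (suc (suc _))    zero             = refl
third-comm (suc (suc _))    (suc zero)       = refl
third-comm (suc (suc _))    (suc (suc _))    = refl

third≢ˡ : ∀ {m} (a b : Fin (3 + m)) → third a b ≢ a
third≢ˡ zero             zero             ()
third≢ˡ zero             (suc zero)       ()
third≢ˡ zero             (suc (suc _))    ()
third≢ˡ (suc zero)       zero             ()
third≢ˡ (suc zero)       (suc zero)       ()
third≢ˡ (suc zero)       (suc (suc _))    ()
third≢ˡ (suc (suc _))    zero             ()
third≢ˡ (suc (suc _))    (suc zero)       ()
third≢ˡ (suc (suc _))    (suc (suc _))    ()

third≢ʳ : ∀ {m} (a b : Fin (3 + m)) → third a b ≢ b
third≢ʳ a b eq = third≢ˡ b a (trans (third-comm b a) eq)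

module ProperToRlid {m n : ℕ} (G : Graph n) (c : Fin n → Fin (3 + m))
                    (proper : IsProperColouring (Edge G) c) where

  EdgeColourAt : Fin n → Fin (3 + m) → Set
  EdgeColourAt x a = ∃[ y ] Edge G x y × third (c x) (c y) ≡ a

  edgeColourAt? : ∀ x a → Dec (EdgeColourAt x a)
  edgeColourAt? x a = any? λ y → T? (adj G x y) ×-dec (third (c x) (c y) ≟ a)

  own∉edgeColours : ∀ x → ¬ EdgeColourAt x (c x)
  own∉edgeColours x (y , _ , eq) = third≢ˡ (c x) (c y) eq

  PendantColour : Fin n → Fin (3 + m) → Set
  PendantColour x d =
    ¬ EdgeColourAt x d × (d ≢ c x ⊎ (∀ a → a ≢ c x → EdgeColourAt x a))

  pendantColour : ∀ x → ∃ (PendantColour x)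
  pendantColour x with any? (λ d → ¬? (d ≟ c x) ×-dec ¬? (edgeColourAt? x d))
  ... | yes (d , d≢cx , d∉) = d , d∉ , inj₁ d≢cx
  ... | no none = c x , own∉edgeColours x , inj₂ λ a a≢cx →
          decidable-stable (edgeColourAt? x a) (λ a∉ → none (a , a≢cx , a∉))

  colour : StarV G → Fin (3 + m)
  colour (orig x)    = c x
  colour (pend x)    = proj₁ (pendantColour x)
  colour (sub x y _) = third (c x) (c y)

  Colours : StarV G → Fin (3 + m) → Set
  Colours = ColoursOf (StarE G) colour

  pend-colours : ∀ {x a} → Colours (pend x) a → a ≡ c x ⊎ a ≡ colour (pend x)
  pend-colours (_ , inj₁ refl          , eq) = inj₂ (≡-sym eq)
  pend-colours (_ , inj₂ (pend-orig _) , eq) = inj₁ (≡-sym eq)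

  sub-colours : ∀ {x y e a} → Colours (sub x y e) a → a ≡ c x ⊎ a ≡ third (c x) (c y)
  sub-colours         (_ , inj₁ refl              , eq) = inj₂ (≡-sym eq)
  sub-colours         (_ , inj₂ (sub-orig _ _ _)  , eq) = inj₁ (≡-sym eq)
  sub-colours {x} {y} (_ , inj₂ (sub-sub _ _ _ _) , eq) =
    inj₂ (trans (≡-sym eq) (third-comm (c y) (c x)))

  orig-pend-separated : ∀ x y (e : Edge G x y) →
    Separates (StarE G) colour (orig x) (pend x) (third (c x) (c y))
  orig-pend-separated x y e =
    neighbour-colour (StarE G) colour (orig-sub x y e) ,
    [ third≢ˡ (c x) (c y) , (λ eq → proj₁ (proj₂ (pendantColour x)) (y , e , eq)) ]
      ∘ pend-colours

  orig-sub-separated : ∀ x y e → ∃ (Separates (StarE G) colour (orig x) (sub x y e))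
  orig-sub-separated x y e with proj₂ (proj₂ (pendantColour x))
  ... | inj₁ d≢cx =
    colour (pend x) , neighbour-colour (StarE G) colour (orig-pend x) ,
    [ d≢cx , (λ eq → proj₁ (proj₂ (pendantColour x)) (y , e , ≡-sym eq)) ]
      ∘ sub-colours
  ... | inj₂ allEdgeColours with allEdgeColours a (third≢ˡ (c x) b)
    where
    b a : Fin (3 + m)
    b = third (c x) (c y)
    a = third (c x) b
  ...   | y′ , e′ , eq =
    _ , (sub x y′ e′ , inj₂ (orig-sub x y′ e′) , eq) ,
    [ third≢ˡ (c x) _ , third≢ʳ (c x) _ ] ∘ sub-colours

  sub-sub-separated : ∀ x y e e′ →
    Separates (StarE G) colour (sub x y e) (sub y x e′) (c x)
  sub-sub-separated x y e e′ =
    neighbour-colour (StarE G) colour (sub-orig x y e) ,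
    [ proper x y e , (λ eq → third≢ʳ (c y) (c x) (≡-sym eq)) ] ∘ sub-colours

  isolated⇒twins : ∀ x → ¬ (∃[ y ] Edge G x y) →
    SameClosedNbhd (StarE G) (orig x) (pend x)
  isolated⇒twins x isolated z = mk⇔ to from
    where
    to : ClosedNbhd (StarE G) (orig x) z → ClosedNbhd (StarE G) (pend x) z
    to (inj₁ refl)             = inj₂ (pend-orig x)
    to (inj₂ (orig-pend _))    = inj₁ refl
    to (inj₂ (orig-sub _ y e)) = ⊥-elim (isolated (y , e))
    from : ClosedNbhd (StarE G) (pend x) z → ClosedNbhd (StarE G) (orig x) z
    from (inj₁ refl)          = inj₂ (orig-pend x)
    from (inj₂ (pend-orig _)) = inj₁ refl

  orig-pend-separated-unless-twins : ∀ x → ¬ SameClosedNbhd (StarE G) (orig x) (pend x) →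
    ∃ (Separates (StarE G) colour (orig x) (pend x))
  orig-pend-separated-unless-twins x notTwins with any? (λ y → T? (adj G x y))
  ... | yes (y , e)  = _ , orig-pend-separated x y e
  ... | no isolated = ⊥-elim (notTwins (isolated⇒twins x isolated))

  rlid : IsRlidColouring (StarE G) colour
  rlid _ _ (orig-pend x) notTwins =
    separates⇒¬SameColours (StarE G) colour
      (proj₂ (orig-pend-separated-unless-twins x notTwins))
  rlid _ _ (pend-orig x) notTwins =
    separates⇒¬SameColours′ (StarE G) colour
      (proj₂ (orig-pend-separated-unless-twins x (notTwins ∘ λ twins z → ⇔-sym (twins z))))
  rlid _ _ (orig-sub x y e) _ =
    separates⇒¬SameColours (StarE G) colour (proj₂ (orig-sub-separated x y e))
  rlid _ _ (sub-orig x y e) _ =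
    separates⇒¬SameColours′ (StarE G) colour (proj₂ (orig-sub-separated x y e))
  rlid _ _ (sub-sub x y e e′) _ =
    separates⇒¬SameColours (StarE G) colour (sub-sub-separated x y e e′)

module RlidToProper {n : ℕ} (G : Graph n) {C : Set} (col : StarV G → C) where

  sub-sub-not-twins : ∀ x y e e′ → ¬ SameClosedNbhd (StarE G) (sub x y e) (sub y x e′)
  sub-sub-not-twins x y e e′ twins
    with Equivalence.to (twins (orig x)) (inj₂ (sub-orig x y e))
  ... | inj₂ (sub-orig _ _ e′) = subst T (irrefl G x) e′

  sub-colours-transfer : ∀ {x y} e e′ → col (orig x) ≡ col (orig y) →
    ∀ a → ColoursOf (StarE G) col (sub x y e) a → ColoursOf (StarE G) col (sub y x e′) a
  sub-colours-transfer {x} {y} e e′ _  a (_ , inj₁ refl , eq) =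
    sub x y e , inj₂ (sub-sub y x e′ e) , eq
  sub-colours-transfer {x} {y} e e′ cx≡cy a (_ , inj₂ (sub-orig _ _ _) , eq) =
    orig y , inj₂ (sub-orig y x e′) , trans (≡-sym cx≡cy) eq
  sub-colours-transfer {x} {y} e e′ _  a (_ , inj₂ (sub-sub _ _ _ e″) , eq) =
    sub y x e″ , inj₁ (cong (sub y x) (T-irrelevant e″ e′)) , eq

  rlid⇒proper : IsRlidColouring (StarE G) col → IsProperColouring (Edge G) (col ∘ orig)
  rlid⇒proper rlid x y e cx≡cy =
    rlid (sub x y e) (sub y x e′) (sub-sub x y e e′) (sub-sub-not-twins x y e e′)
      λ a → mk⇔ (sub-colours-transfer e e′ cx≡cy a)
                (sub-colours-transfer e′ e (≡-sym cx≡cy) a)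
    where
    e′ : Edge G y x
    e′ = subst T (Graph.sym G x y) e

mainTheorem3 : (k : ℕ) → k ≥ 3 → {n : ℕ} (G : Graph n) →
    Connected (Edge G) → TwinFree (Edge G) →
    (Σ (Fin n → Fin k) (IsProperColouring (Edge G)))
      ⇔ (Σ (StarV G → Fin k) (IsRlidColouring (StarE G)))
mainTheorem3 (suc (suc (suc m))) (s≤s (s≤s (s≤s _))) G _ _ = mk⇔
  (λ (c , proper) → let open ProperToRlid G c proper in colour , rlid)
  (λ (col , rlid) → col ∘ orig , RlidToProper.rlid⇒proper G col rlid)
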